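{- The solver $SAT_{\mathcal{RQ}}$ can be implemented so as to terminate on every conjunction of pure $\Phi_{\exists\forall}$ constraints, i.e. on every finite conjunction of constraints of the form $exists(x_1\in A_1,\dots exists(x_k\in A_k, foreach(y_1\in B_1,\dots foreach(y_m\in B_m,\phi)\dots))\dots)$ with $k\ge1$, $m\ge0$, $x_i,y_j$ control terms, $A_i,B_j$ extensional set terms and $\phi$ an $\mathcal{X}$-formula (when $m=0$, $\phi$ is the innermost filter).
   Context: Setting. $\mathcal{X}$ is a first-order theory with admissible quantifier-free $\mathcal{X}$-formulas (including $=_\mathcal{X}$ and a pairing symbol) and a decision procedure $SAT_\mathcal{X}$. Standing assumptions: set and element variables are disjoint sorts, and $\mathcal{X}$'s predicates are disjoint from the set predicates $=_\mathcal{S},\in,\subseteq$. In $\mathcal{L}_{\mathcal{RQ}}(\mathcal{X})$: control terms are element variables or nested pairs of control terms (distinct variables); extensional set terms are $\varnothing$, set variables, and $\{e\sqcup E\}$ (meaning $\{e\}\cup E$); RIS terms $\{c:D\mid\phi\}$ denote the instances of $c$ in $D$ satisfying $\phi$. $foreach(c\in A,\phi)$ abbreviates $A\subseteq\{c:A\mid\phi\}$; $exists(c\in A,\phi)$ abbreviates $n\in A\land\phi(n)$ with $n$ a term whose variables are fresh. Solver $SAT_{\mathcal{RQ}}$: repeatedly applies non-deterministic rewrite rules to set constraints until a fixpoint (first applicable rule in listed order; disjunctive right sides branch; $N$ fresh), then calls $SAT_\mathcal{X}$ on the $\mathcal{X}$-part. Rules ($\dot A$ a variable): $\varnothing\subseteq\{x:\varnothing\mid\phi\}\to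 true$; $\{a\sqcup A\}\subseteq\{x:\{a\sqcup A\}\mid\phi(x)\}\to\phi(a)\land A\subseteq\{x:A\mid\phi(x)\}$; $\dot A\subseteq\{x:\dot A\mid\phi\}$ irreducible; $a\in\varnothing\to false$; $a\in\{b\sqcup A\}\to a=_\mathcal{X}b\lor a\in A$; $a\in\dot A\to\dot A=\{a\sqcup N\}$; $\varnothing=\varnothing\to true$; $\dot A=\dot A\to true$; $B=\dot A\to\dot A=B$ if $B$ not a variable; $\dot A=B\to\dot A=B$ and substitute $B$ for $\dot A$ elsewhere; $\{a\sqcup A\}=\varnothing\to false$; $\varnothing=\{a\sqcup A\}\to false$; $\{a\sqcup A\}=\{b\sqcup B\}\to(a=_\mathcal{X}b\land A=B)\lor(a=_\mathcal{X}b\land\{a\sqcup A\}=B)\lor(a=_\mathcal{X}b\land A=\{b\sqcup B\})\lor(A=\{b\sqcup N\}\land B=\{a\sqcup N\})$; $\dot A=B$ irreducible if $\dot A$ occurs nowhere else. "Terminates" means every non-deterministic branch terminates. -}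

module Defs where

open import Data.Nat using (ℕ; zero; suc; _<_; _≡ᵇ_)
open import Data.Bool using (Bool; true; false; if_then_else_; _∨_)
open import Data.Bool.ListAction using (any)
open import Data.List using (List; []; _∷_; _++_; length; lookup; removeAt; concatMap)
open import Data.Fin using (Fin)
open import Data.Maybe using (Maybe; just; nothing)
open import Data.Product using (Σ; _×_; _,_)
open import Data.List.Membership.Propositional using (_∈_)
open import Relation.Binary.PropositionalEquality using (_≡_)
open import Induction.WellFounded using (Acc)

-- The underlying theory 𝒳, abstractly: its (quantifier-free) terms and
-- formulas, variables (ℕ-named), the pairing symbol, =_𝒳, substitution
-- of a term for an element variable, and the variables occurring.
-- (SAT_𝒳 is a decision procedure, hence terminating; it is not modelled,
--  termination of SAT_RQ is termination of the rewriting phase.)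

record XTheory : Set₁ where
  field
    Tm     : Set
    var    : ℕ → Tm
    pair   : Tm → Tm → Tm
    substT : ℕ → Tm → Tm → Tm        -- substT x a t  =  t[a/x]
    varsT  : Tm → List ℕ
    Fm     : Set
    eqX    : Tm → Tm → Fm
    substF : ℕ → Tm → Fm → Fm        -- substF x a φ  =  φ[a/x]
    varsF  : Fm → List ℕ

module _ (X : XTheory) where
  open XTheory X

  data CT : Set where
    cv : ℕ → CT
    cp : CT → CT → CT

  ctTm : CT → Tm
  ctTm (cv x)   = var x
  ctTm (cp c d) = pair (ctTm c) (ctTm d)

  ctVars : CT → List ℕ
  ctVars (cv x)   = x ∷ []
  ctVars (cp c d) = ctVars c ++ ctVars d

  -- extensional set terms: ∅, set variables, {e ⊔ E}
  data STm : Set where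
    ∅    : STm
    svar : ℕ → STm
    ins  : Tm → STm → STm

  -- constraints.  foreach c A φ  is  A ⊆ {c : A | φ}  (the only shape of
  -- ⊆-constraint handled by the rules); its filter is a conjunction.
  data Con : Set where
    xf      : Fm → Con
    mem     : Tm → STm → Con
    eqS     : STm → STm → Con
    foreach : CT → STm → List Con → Con

  -- element substitution  [a/x]  (respecting the binder of RIS filters)
  substS : ℕ → Tm → STm → STm
  substS x a ∅         = ∅
  substS x a (svar v)  = svar v
  substS x a (ins e E) = ins (substT x a e) (substS x a E)

  mutual
    substC : ℕ → Tm → Con → Con
    substC x a (xf f)          = xf (substF x a f)
    substC x a (mem e E)       = mem (substT x a e) (substS x a E)
    substC x a (eqS A B)       = eqS (substS x a A) (substS x a B)
    substC x a (foreach c A φ) =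
      foreach c (substS x a A) (if any (x ≡ᵇ_) (ctVars c) then φ else substL x a φ)

    substL : ℕ → Tm → List Con → List Con
    substL x a []       = []
    substL x a (c ∷ cs) = substC x a c ∷ substL x a cs

  ssubS : ℕ → STm → STm → STm
  ssubS v B ∅         = ∅
  ssubS v B (svar w)  = if v ≡ᵇ w then B else svar w
  ssubS v B (ins e E) = ins e (ssubS v B E)

  mutual
    ssubC : ℕ → STm → Con → Con
    ssubC v B (xf f)          = xf f
    ssubC v B (mem e E)       = mem e (ssubS v B E)
    ssubC v B (eqS A A')      = eqS (ssubS v B A) (ssubS v B A')
    ssubC v B (foreach c A φ) = foreach c (ssubS v B A) (ssubL v B φ)

    ssubL : ℕ → STm → List Con → List Con
    ssubL v B []       = []
    ssubL v B (c ∷ cs) = ssubC v B c ∷ ssubL v B cs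

  occS : ℕ → STm → Bool
  occS v ∅         = false
  occS v (svar w)  = v ≡ᵇ w
  occS v (ins e E) = occS v E

  mutual
    occC : ℕ → Con → Bool
    occC v (xf f)          = false
    occC v (mem e E)       = occS v E
    occC v (eqS A B)       = occS v A ∨ occS v B
    occC v (foreach c A φ) = occS v A ∨ occL v φ

    occL : ℕ → List Con → Bool
    occL v []       = false
    occL v (c ∷ cs) = occC v c ∨ occL v cs

  varsS : STm → List ℕ
  varsS ∅         = []
  varsS (svar v)  = v ∷ []
  varsS (ins e E) = varsT e ++ varsS E

  mutual
    varsC : Con → List ℕ
    varsC (xf f)          = varsF f
    varsC (mem e E)       = varsT e ++ varsS E
    varsC (eqS A B)       = varsS A ++ varsS B
    varsC (foreach c A φ) = ctVars c ++ varsS A ++ varsL φ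

    varsL : List Con → List ℕ
    varsL []       = []
    varsL (c ∷ cs) = varsC c ++ varsL cs

  -- φ(a) for a filter φ with control term c; k is the fresh-name counter.
  -- For a variable control term x this is φ[a/x]; for a pair control term
  -- the variables of c are renamed to fresh ones c' and a =_𝒳 c' is added.
  freshen : CT → ℕ → CT × List (ℕ × ℕ) × ℕ
  freshen (cv x) k = cv k , (x , k) ∷ [] , suc k
  freshen (cp c d) k with freshen c k
  ... | c' , m₁ , k₁ with freshen d k₁
  ... | d' , m₂ , k₂ = cp c' d' , m₁ ++ m₂ , k₂

  renameL : List (ℕ × ℕ) → List Con → List Con
  renameL []            φ = φ
  renameL ((y , z) ∷ m) φ = renameL m (substL y (var z) φ)

  inst : CT → Tm → List Con → ℕ → List Con × ℕ
  inst (cv x) a φ k = substL x a φ , k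
  inst (cp c d) a φ k with freshen (cp c d) k
  ... | c' , m , k' = xf (eqX a (ctTm c')) ∷ renameL m φ , k'

  record State : Set where
    constructor ⟨_,_⟩
    field
      cons : List Con
      ctr  : ℕ
  open State public

  varEq : ℕ → STm → List Con → ℕ → Maybe (List State)
  varEq v B rest k =
    if occL v rest then just (⟨ eqS (svar v) B ∷ ssubL v B rest , k ⟩ ∷ []) else nothing

  -- The rewrite rules applied to one selected constraint (the first
  -- applicable one, in the listed order).  `rest` = the other constraints.
  -- nothing = irreducible; just bs = the (non-deterministic) branches;
  -- just [] = false (the branch fails).
  rule : Con → List Con → ℕ → Maybe (List State)
  rule (xf _) rest k = nothing
  rule (foreach c ∅ φ) rest k = just (⟨ rest , k ⟩ ∷ [])
  rule (foreach c (ins a A) φ) rest k with inst c a φ k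
  ... | φa , k' = just (⟨ φa ++ (foreach c A φ ∷ rest) , k' ⟩ ∷ [])
  rule (foreach c (svar _) φ) rest k = nothing
  rule (mem a ∅) rest k = just []
  rule (mem a (ins b B)) rest k =
    just (⟨ xf (eqX a b) ∷ rest , k ⟩ ∷ ⟨ mem a B ∷ rest , k ⟩ ∷ [])
  rule (mem a (svar v)) rest k =
    just (⟨ eqS (svar v) (ins a (svar k)) ∷ rest , suc k ⟩ ∷ [])
  rule (eqS ∅ ∅) rest k = just (⟨ rest , k ⟩ ∷ [])
  rule (eqS (svar v) (svar w)) rest k =
    if v ≡ᵇ w then just (⟨ rest , k ⟩ ∷ []) else varEq v (svar w) rest k
  rule (eqS ∅ (svar v)) rest k = just (⟨ eqS (svar v) ∅ ∷ rest , k ⟩ ∷ [])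
  rule (eqS (ins a A) (svar v)) rest k = just (⟨ eqS (svar v) (ins a A) ∷ rest , k ⟩ ∷ [])
  rule (eqS (svar v) B) rest k = varEq v B rest k
  rule (eqS (ins a A) ∅) rest k = just []
  rule (eqS ∅ (ins b B)) rest k = just []
  rule (eqS (ins a A) (ins b B)) rest k = just
    ( ⟨ xf (eqX a b) ∷ eqS A B ∷ rest , k ⟩
    ∷ ⟨ xf (eqX a b) ∷ eqS (ins a A) B ∷ rest , k ⟩
    ∷ ⟨ xf (eqX a b) ∷ eqS A (ins b B) ∷ rest , k ⟩
    ∷ ⟨ eqS A (ins b (svar k)) ∷ eqS B (ins a (svar k)) ∷ rest , suc k ⟩
    ∷ [])

  ruleAt : (s : State) → Fin (length (cons s)) → Maybe (List State)
  ruleAt s i = rule (lookup (cons s) i) (removeAt (cons s) i) (ctr s)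

  -- An implementation of SAT_RQ: a (deterministic) choice of which
  -- constraint to rewrite next; it must pick a reducible constraint and
  -- may stop only at a fixpoint (no constraint is reducible).
  record Implementation : Set where
    field
      choose     : (s : State) → Maybe (Fin (length (cons s)))
      choose-red : ∀ s i → choose s ≡ just i → Σ (List State) (λ bs → ruleAt s i ≡ just bs)
      choose-fix : ∀ s → choose s ≡ nothing → ∀ i → ruleAt s i ≡ nothing

  Step : Implementation → State → State → Set
  Step impl s s' =
    Σ (Fin (length (cons s))) λ i →
      Implementation.choose impl s ≡ just i ×
      Σ (List State) λ bs → ruleAt s i ≡ just bs × s' ∈ bs

  Terminates : Implementation → State → Set
  Terminates impl s = Acc (λ s' s₀ → Step impl s₀ s') s

  record PureEA : Set where
    field
      ex₁  : CT × STm
      exs  : List (CT × STm)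
      fas  : List (CT × STm)
      body : Fm

  foreachChain : List (CT × STm) → Fm → List Con
  foreachChain []            φ = xf φ ∷ []
  foreachChain ((y , B) ∷ r) φ = foreach y B (foreachChain r φ) ∷ []

  -- exists(x∈A, ψ) = n∈A ∧ ψ(n) with n a term with fresh variables; we take
  -- n := x itself (its variables are bound, hence fresh), so ψ(n) = ψ.
  existsChain : List (CT × STm) → List Con → List Con
  existsChain []            ψ = ψ
  existsChain ((x , A) ∷ r) ψ = mem (ctTm x) A ∷ existsChain r ψ

  pureCons : PureEA → List Con
  pureCons p = existsChain (PureEA.ex₁ p ∷ PureEA.exs p) (foreachChain (PureEA.fas p) (PureEA.body p))

  conjCons : List PureEA → List Con
  conjCons = concatMap pureCons

  FreshFor : ℕ → List Con → Set
  FreshFor k Γ = ∀ v → v ∈ varsL Γ → v < k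

-- The implementation rewrites a reducible equation Ȧ = B before any other constraint.  Starting
-- from pure Φ∃∀ constraints, every reachable constraint is then an 𝒳-formula, a membership, an
-- equation Ȧ = {a ⊔ A} with Ȧ not in {a ⊔ A}, or a foreach whose filter is pure (built from
-- 𝒳-formulas and foreach only), and at most one equation is live, i.e. has its variable occurring
-- in another constraint.  Each step decreases lexicographically
--   (number of memberships, number of live equations, total size of the membership sets, weight)
-- where foreach(c ∈ {a₁,…,aₙ ⊔ A}, φ) weighs (n + 1)(2 + weight φ): instantiating a foreach only
-- adds pure constraints, a ∈ Ȧ trades a membership for one equation, and eliminating a live
-- equation leaves it dead without touching the memberships.

module Submission where

open import Defs
open import Data.Bool using (Bool; true; false; T; _∧_; _∨_; if_then_else_)
open import Data.Bool.Properties using (∨-conicalˡ; ∨-conicalʳ; T-∧)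
open import Data.Bool.ListAction using (any)
open import Data.Fin using (Fin; zero; suc)
open import Data.Fin.Properties using (any?)
open import Data.List using (List; []; _∷_; _++_; [_]; length; lookup; removeAt; map)
open import Data.List.Properties using (tabulate-lookup; map-++; map-cong; ++-assoc)
open import Data.List.Membership.Propositional using (_∈_)
open import Data.List.Membership.Propositional.Properties using (∈-++⁺ˡ; ∈-++⁺ʳ; ∈-lookup)
open import Data.List.Relation.Unary.All as All using (All; []; _∷_)
open import Data.List.Relation.Unary.All.Properties using (++⁺; tabulate⁺)
open import Data.List.Relation.Unary.Any using (here; there)
open import Data.List.Relation.Binary.Permutation.Propositional
  using (_↭_; ↭-refl; ↭-sym; ↭-trans; ↭-prep; ↭-swap)
open import Data.List.Relation.Binary.Permutation.Propositional.Properties using (All-resp-↭; map⁺)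
open import Data.Maybe using (Maybe; just; nothing; maybe; is-just)
open import Data.Nat using (ℕ; zero; suc; _+_; _*_; _≤_; _<_; z≤n; s≤s; _≡ᵇ_)
open import Data.Nat.Properties
open import Data.Nat.ListAction using (sum)
open import Data.Nat.ListAction.Properties using (sum-++; sum-↭)
open import Data.Nat.Induction using (<-wellFounded)
open import Data.Product using (Σ; _×_; _,_; proj₁; proj₂)
open import Data.Product.Relation.Binary.Lex.Strict using (×-Lex; ×-wellFounded)
open import Data.Sum using (_⊎_; inj₁; inj₂)
open import Function using (_∘_; Equivalence)
open import Induction.WellFounded using (Acc; acc; WellFounded)
open import Relation.Binary.PropositionalEquality hiding ([_])
open import Relation.Nullary using (¬_; yes; no; contradiction)
open import Relation.Nullary.Decidable using (T?)
open import Relation.Unary using (Decidable)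

module _ {A : Set} where

  lookup∷removeAt↭ : (xs : List A) (i : Fin (length xs)) → lookup xs i ∷ removeAt xs i ↭ xs
  lookup∷removeAt↭ (x ∷ xs) zero    = ↭-refl
  lookup∷removeAt↭ (x ∷ xs) (suc i) = ↭-trans (↭-swap _ x ↭-refl) (↭-prep x (lookup∷removeAt↭ xs i))

  All-lookup⁺ : {P : A → Set} (xs : List A) → (∀ i → P (lookup xs i)) → All P xs
  All-lookup⁺ xs h = subst (All _) (tabulate-lookup xs) (tabulate⁺ h)

  sum-map-↭ : (f : A → ℕ) {xs ys : List A} → xs ↭ ys → sum (map f xs) ≡ sum (map f ys)
  sum-map-↭ f p = sum-↭ (map⁺ f p)

  sum-map-++ : (f : A → ℕ) (xs ys : List A) → sum (map f (xs ++ ys)) ≡ sum (map f xs) + sum (map f ys)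
  sum-map-++ f xs ys = trans (cong sum (map-++ f xs ys)) (sum-++ (map f xs) (map f ys))

  sum-map-≡0⁺ : (f : A → ℕ) {xs : List A} → All (λ x → f x ≡ 0) xs → sum (map f xs) ≡ 0
  sum-map-≡0⁺ f []       = refl
  sum-map-≡0⁺ f (p ∷ ps) = cong₂ _+_ p (sum-map-≡0⁺ f ps)

  sum-map-≡0⁻ : (f : A → ℕ) (xs : List A) → sum (map f xs) ≡ 0 → All (λ x → f x ≡ 0) xs
  sum-map-≡0⁻ f []       _ = []
  sum-map-≡0⁻ f (x ∷ xs) e = m+n≡0⇒m≡0 (f x) e ∷ sum-map-≡0⁻ f xs (m+n≡0⇒n≡0 (f x) e)

  is-just-if : (b : Bool) {x : A} → is-just (if b then just x else nothing) ≡ b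
  is-just-if true  = refl
  is-just-if false = refl

  is-just⇒≡just : {m : Maybe A} → T (is-just m) → Σ A λ x → m ≡ just x
  is-just⇒≡just {just x} _ = x , refl

  ¬is-just⇒≡nothing : {m : Maybe A} → ¬ T (is-just m) → m ≡ nothing
  ¬is-just⇒≡nothing {just _}  ¬j = contradiction _ ¬j
  ¬is-just⇒≡nothing {nothing} _  = refl

≡ᵇ-refl : ∀ n → (n ≡ᵇ n) ≡ true
≡ᵇ-refl zero    = refl
≡ᵇ-refl (suc n) = ≡ᵇ-refl n

≡ᵇ≡true⇒≡ : ∀ m n → (m ≡ᵇ n) ≡ true → m ≡ n
≡ᵇ≡true⇒≡ m n e = ≡ᵇ⇒≡ m n (subst T (sym e) _)

≡ᵇ≡false⇒≢ : ∀ {m n} → (m ≡ᵇ n) ≡ false → m ≢ n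
≡ᵇ≡false⇒≢ {m} e refl = contradiction (trans (sym (≡ᵇ-refl m)) e) λ ()

≢⇒≡ᵇ≡false : ∀ {m n} → m ≢ n → (m ≡ᵇ n) ≡ false
≢⇒≡ᵇ≡false {m} {n} m≢n with m ≡ᵇ n in e
... | true  = contradiction (≡ᵇ≡true⇒≡ m n e) m≢n
... | false = refl

∨≡true⇒ : ∀ a {b} → (a ∨ b) ≡ true → a ≡ true ⊎ b ≡ true
∨≡true⇒ true  _ = inj₁ refl
∨≡true⇒ false e = inj₂ e

oneIf : Bool → ℕ
oneIf true  = 1
oneIf false = 0

oneIf-T : ∀ {b} → T b → oneIf b ≡ 1
oneIf-T {true} _ = refl

oneIf-¬T : ∀ {b} → ¬ T b → oneIf b ≡ 0
oneIf-¬T {true}  ¬t = contradiction _ ¬t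
oneIf-¬T {false} _  = refl

atLeastTwo : ℕ → ℕ
atLeastTwo (suc (suc _)) = 1
atLeastTwo _             = 0

atLeastTwo≤1 : ∀ n → atLeastTwo n ≤ 1
atLeastTwo≤1 zero          = z≤n
atLeastTwo≤1 (suc zero)    = z≤n
atLeastTwo≤1 (suc (suc n)) = s≤s z≤n

atLeastTwo≡0⇒≤1 : ∀ {n} → atLeastTwo n ≡ 0 → n ≤ 1
atLeastTwo≡0⇒≤1 {zero}     _ = z≤n
atLeastTwo≡0⇒≤1 {suc zero} _ = s≤s z≤n

module Termination (X : XTheory) where
  open XTheory X

  C : Set
  C = Con X

  data Pure : C → Set where
    xf-pure      : ∀ {f} → Pure (xf f)
    foreach-pure : ∀ {c A φ} → All Pure φ → Pure (foreach c A φ)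

  data Good : C → Set where
    xf-good      : ∀ {f} → Good (xf f)
    mem-good     : ∀ {a A} → Good (mem a A)
    eq-good      : ∀ {v a A} → occS X v (ins a A) ≡ false → Good (eqS (svar v) (ins a A))
    foreach-good : ∀ {c A φ} → All Pure φ → Good (foreach c A φ)

  Pure⇒Good : ∀ {c} → Pure c → Good c
  Pure⇒Good xf-pure          = xf-good
  Pure⇒Good (foreach-pure p) = foreach-good p

  Absent : ℕ → C → Set
  Absent v c = occC X v c ≡ false

  occL≡false⇒All : ∀ v Γ → occL X v Γ ≡ false → All (Absent v) Γ
  occL≡false⇒All v []      _ = []
  occL≡false⇒All v (c ∷ Γ) e = ∨-conicalˡ _ _ e ∷ occL≡false⇒All v Γ (∨-conicalʳ _ _ e)

  Fresh : ℕ → List C → Set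
  Fresh k Γ = ∀ v → k ≤ v → All (Absent v) Γ

  occurs⇒<fresh : ∀ {k Γ d w} → Fresh k Γ → d ∈ Γ → occC X w d ≡ true → w < k
  occurs⇒<fresh {k} {w = w} fresh d∈Γ occurs with w <? k
  ... | yes w<k = w<k
  ... | no  w≮k = contradiction (trans (sym occurs) (All.lookup (fresh w (≮⇒≥ w≮k)) d∈Γ)) λ ()

  -- Counting occurrences and live equations

  occurrences : ℕ → List C → ℕ
  occurrences v Γ = sum (map (oneIf ∘ occC X v) Γ)

  occurrences-absent : ∀ {v Δ} → All (Absent v) Δ → occurrences v Δ ≡ 0
  occurrences-absent = sum-map-≡0⁺ _ ∘ All.map (cong oneIf)

  occurrences-↭ : ∀ v {Γ Γ'} → Γ ↭ Γ' → occurrences v Γ ≡ occurrences v Γ'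
  occurrences-↭ v = sum-map-↭ (oneIf ∘ occC X v)

  occurrences-head : ∀ v B rest → occurrences v (eqS (svar v) B ∷ rest) ≡ suc (occurrences v rest)
  occurrences-head v B rest = cong (λ b → oneIf (b ∨ occS X v B) + occurrences v rest) (≡ᵇ-refl v)

  atLeastTwo-occurrences : ∀ v Γ → atLeastTwo (suc (occurrences v Γ)) ≡ oneIf (occL X v Γ)
  atLeastTwo-occurrences v []      = refl
  atLeastTwo-occurrences v (c ∷ Γ) with occC X v c
  ... | true  = refl
  ... | false = atLeastTwo-occurrences v Γ

  occurrences⁺ : ∀ {w d Γ} → d ∈ Γ → occC X w d ≡ true → 1 ≤ occurrences w Γ
  occurrences⁺ (here refl) occurs rewrite occurs = s≤s z≤n
  occurrences⁺ {w} {Γ = c ∷ _} (there d∈Γ) occurs =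
    ≤-trans (occurrences⁺ d∈Γ occurs) (m≤n+m _ (oneIf (occC X w c)))

  occurs-once : ∀ c {w d rest} → d ∈ rest → occC X w d ≡ true → occurrences w (c ∷ rest) ≤ 1 →
                Absent w c × occurrences w rest ≡ 1
  occurs-once c {w} d∈rest occurs once with occC X w c | occurrences⁺ d∈rest occurs
  ... | true  | 1≤n = contradiction (≤-trans 1≤n (≤-pred once)) λ ()
  ... | false | 1≤n = refl , ≤-antisym once 1≤n

  equationVar : C → Maybe ℕ
  equationVar (eqS (svar v) _) = just v
  equationVar _                = nothing

  equationVar-occurs : ∀ d {w} → equationVar d ≡ just w → occC X w d ≡ true
  equationVar-occurs (eqS (svar v) B) refl = cong (_∨ occS X v B) (≡ᵇ-refl v)
  equationVar-occurs (xf _)           ()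
  equationVar-occurs (mem _ _)        ()
  equationVar-occurs (eqS ∅ _)        ()
  equationVar-occurs (eqS (ins _ _) _) ()
  equationVar-occurs (foreach _ _ _)  ()

  liveness : List C → C → ℕ
  liveness Γ d = maybe (λ v → atLeastTwo (occurrences v Γ)) 0 (equationVar d)

  live : List C → ℕ
  live Γ = sum (map (liveness Γ) Γ)

  Dead : List C → List C → Set
  Dead Γ Δ = All (λ d → liveness Γ d ≡ 0) Δ

  liveness-nothing : ∀ Γ {d} → equationVar d ≡ nothing → liveness Γ d ≡ 0
  liveness-nothing Γ e = cong (maybe _ 0) e

  liveness≤1 : ∀ Γ d → liveness Γ d ≤ 1
  liveness≤1 Γ d with equationVar d
  ... | just v  = atLeastTwo≤1 (occurrences v Γ)
  ... | nothing = z≤n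

  liveness-↭ : ∀ {Γ Γ'} → Γ ↭ Γ' → ∀ d → liveness Γ d ≡ liveness Γ' d
  liveness-↭ p d with equationVar d
  ... | just v  = cong atLeastTwo (occurrences-↭ v p)
  ... | nothing = refl

  live-↭ : ∀ {Γ Γ'} → Γ ↭ Γ' → live Γ ≡ live Γ'
  live-↭ {Γ' = Γ'} p = trans (sum-map-↭ _ p) (cong sum (map-cong (liveness-↭ p) Γ'))

  Dead-↭ : ∀ {Γ Γ' Δ Δ'} → Γ ↭ Γ' → Δ ↭ Δ' → Dead Γ Δ → Dead Γ' Δ'
  Dead-↭ p q = All-resp-↭ q ∘ All.map (λ {d} e → trans (sym (liveness-↭ p d)) e)

  live-++ : ∀ Δ rest → Dead (Δ ++ rest) rest →
            live (Δ ++ rest) ≡ sum (map (liveness (Δ ++ rest)) Δ)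
  live-++ Δ rest dead = begin
    live Γ'                              ≡⟨ sum-map-++ (liveness Γ') Δ rest ⟩
    liveΔ + sum (map (liveness Γ') rest) ≡⟨ cong (liveΔ +_) (sum-map-≡0⁺ _ dead) ⟩
    liveΔ + 0                            ≡⟨ +-identityʳ liveΔ ⟩
    liveΔ                                ∎
    where
      Γ' = Δ ++ rest
      liveΔ = sum (map (liveness Γ') Δ)
      open ≡-Reasoning

  liveness-equation : ∀ v B rest →
                      liveness (eqS (svar v) B ∷ rest) (eqS (svar v) B) ≡ oneIf (occL X v rest)
  liveness-equation v B rest =
    trans (cong atLeastTwo (occurrences-head v B rest)) (atLeastTwo-occurrences v rest)

  -- Invariant and measure

  record Invariant (k : ℕ) (Γ : List C) : Set where
    field
      good   : All Good Γ
      fresh  : Fresh k Γ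
      live≤1 : live Γ ≤ 1
  open Invariant

  Invariant-↭ : ∀ {k Γ Γ'} → Γ ↭ Γ' → Invariant k Γ → Invariant k Γ'
  Invariant-↭ p inv = record
    { good   = All-resp-↭ p (good inv)
    ; fresh  = λ v k≤v → All-resp-↭ p (fresh inv v k≤v)
    ; live≤1 = subst (_≤ 1) (live-↭ p) (live≤1 inv)
    }

  membership : C → ℕ
  membership (mem _ _) = 1
  membership _         = 0

  size : STm X → ℕ
  size (ins _ A) = suc (size A)
  size _         = 0

  memberSize : C → ℕ
  memberSize (mem _ A) = size A
  memberSize _         = 0

  mutual
    weight : C → ℕ
    weight (foreach _ A φ) = suc (size A) * (2 + weights φ)
    weight _               = 0

    weights : List C → ℕ
    weights []      = 0
    weights (c ∷ φ) = weight c + weights φ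

  weights≡sum : ∀ φ → weights φ ≡ sum (map weight φ)
  weights≡sum []      = refl
  weights≡sum (c ∷ φ) = cong (weight c +_) (weights≡sum φ)

  μ : List C → ℕ × ℕ × ℕ × ℕ
  μ Γ = sum (map membership Γ) , live Γ , sum (map memberSize Γ) , sum (map weight Γ)

  _⊏_ : ℕ × ℕ × ℕ × ℕ → ℕ × ℕ × ℕ × ℕ → Set
  _⊏_ = ×-Lex _≡_ _<_ (×-Lex _≡_ _<_ (×-Lex _≡_ _<_ _<_))

  ⊏-wellFounded : WellFounded _⊏_
  ⊏-wellFounded =
    ×-wellFounded <-wellFounded (×-wellFounded <-wellFounded (×-wellFounded <-wellFounded <-wellFounded))

  μ-↭ : ∀ {Γ Γ'} → Γ ↭ Γ' → μ Γ ≡ μ Γ'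
  μ-↭ p = cong₂ _,_ (sum-map-↭ _ p)
                   (cong₂ _,_ (live-↭ p) (cong₂ _,_ (sum-map-↭ _ p) (sum-map-↭ _ p)))

  record Advance (s' : State X) (Γ : List C) : Set where
    constructor advance
    field
      invariant : Invariant (ctr s') (cons s')
      decrease  : μ (cons s') ⊏ μ Γ

  -- c is the constraint selected for rewriting, moved to the front.
  record Focused (k : ℕ) (c : C) (rest : List C) : Set where
    field
      good-rest : All Good rest
      fresh     : Fresh k (c ∷ rest)
      rest-dead : Dead (c ∷ rest) rest
  open Focused

  Confined : ℕ → ℕ → C → List C → Set
  Confined k k' c Δ = ∀ w → w < k ⊎ k' ≤ w → Absent w c → All (Absent w) Δ

  dead-after-replacing : ∀ {k k' c rest Δ} → Focused k c rest → Confined k k' c Δ → Dead (Δ ++ rest) rest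
  dead-after-replacing {c = c} {rest} {Δ} f confined =
    All.tabulate λ d∈rest → stays-dead d∈rest (All.lookup (rest-dead f) d∈rest)
    where
      -- The variable of a dead equation occurs in that equation only, so not in c, hence not in Δ.
      stays-dead : ∀ {d} → d ∈ rest → liveness (c ∷ rest) d ≡ 0 → liveness (Δ ++ rest) d ≡ 0
      stays-dead {d} d∈rest dead with equationVar d in e
      ... | nothing = refl
      ... | just w  = cong atLeastTwo (begin
          occurrences w (Δ ++ rest)             ≡⟨ sum-map-++ _ Δ rest ⟩
          occurrences w Δ + occurrences w rest  ≡⟨ cong₂ _+_ (occurrences-absent absentΔ) once ⟩
          1                                     ∎)
        where
          open ≡-Reasoning
          occurs = equationVar-occurs d e
          facts  = occurs-once c d∈rest occurs (atLeastTwo≡0⇒≤1 dead)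
          once   = proj₂ facts
          absentΔ = confined w (inj₁ (occurs⇒<fresh (fresh f) (there d∈rest) occurs)) (proj₁ facts)

  invariant-after-replacing : ∀ {k k' c rest Δ} → Focused k c rest → k ≤ k' → Confined k k' c Δ →
    All Good Δ → sum (map (liveness (Δ ++ rest)) Δ) ≤ 1 → Invariant k' (Δ ++ rest)
  invariant-after-replacing {rest = rest} {Δ} f k≤k' confined goodΔ liveΔ = record
    { good   = ++⁺ goodΔ (good-rest f)
    ; fresh  = λ v k'≤v → let absent = fresh f v (≤-trans k≤k' k'≤v) in
                 ++⁺ (confined v (inj₂ k'≤v) (All.head absent)) (All.tail absent)
    ; live≤1 = subst (_≤ 1) (sym (live-++ Δ rest (dead-after-replacing f confined))) liveΔ
    }

  NoEquations : List C → Set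
  NoEquations = All (λ d → equationVar d ≡ nothing)

  quiet-replacement : ∀ {k k' c rest Δ} → Focused k c rest → equationVar c ≡ nothing → k ≤ k' →
    Confined k k' c Δ → All Good Δ → NoEquations Δ →
    Invariant k' (Δ ++ rest) × live (Δ ++ rest) ≡ live (c ∷ rest)
  quiet-replacement {c = c} {rest} {Δ} f c-quiet k≤k' confined goodΔ quietΔ =
    invariant-after-replacing f k≤k' confined goodΔ (≤-trans (≤-reflexive quiet-new) z≤n) ,
    trans (trans (live-++ Δ rest (dead-after-replacing f confined)) quiet-new) (sym quiet-old)
    where
      quiet-new : sum (map (liveness (Δ ++ rest)) Δ) ≡ 0
      quiet-new = sum-map-≡0⁺ (liveness (Δ ++ rest)) (All.map (liveness-nothing (Δ ++ rest)) quietΔ)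
      quiet-old : live (c ∷ rest) ≡ 0
      quiet-old = trans (live-++ [ c ] rest (rest-dead f))
                        (cong (_+ 0) (liveness-nothing (c ∷ rest) c-quiet))

  -- Substitutions

  occS-substS : ∀ w x a S → occS X w (substS X x a S) ≡ occS X w S
  occS-substS w x a ∅         = refl
  occS-substS w x a (svar _)  = refl
  occS-substS w x a (ins _ S) = occS-substS w x a S

  size-substS : ∀ x a S → size (substS X x a S) ≡ size S
  size-substS x a ∅         = refl
  size-substS x a (svar _)  = refl
  size-substS x a (ins _ S) = cong suc (size-substS x a S)

  mutual
    Pure-substC : ∀ x a {c} → Pure c → Pure (substC X x a c)
    Pure-substC x a xf-pure = xf-pure
    Pure-substC x a (foreach-pure {c} p) with any (x ≡ᵇ_) (ctVars X c)
    ... | true  = foreach-pure p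
    ... | false = foreach-pure (Pure-substL x a p)

    Pure-substL : ∀ x a {φ} → All Pure φ → All Pure (substL X x a φ)
    Pure-substL x a []       = []
    Pure-substL x a (p ∷ ps) = Pure-substC x a p ∷ Pure-substL x a ps

  mutual
    occC-substC : ∀ w x a c → occC X w (substC X x a c) ≡ occC X w c
    occC-substC w x a (xf _)          = refl
    occC-substC w x a (mem _ S)       = occS-substS w x a S
    occC-substC w x a (eqS S S')      = cong₂ _∨_ (occS-substS w x a S) (occS-substS w x a S')
    occC-substC w x a (foreach c S φ) with any (x ≡ᵇ_) (ctVars X c)
    ... | true  = cong (_∨ occL X w φ) (occS-substS w x a S)
    ... | false = cong₂ _∨_ (occS-substS w x a S) (occL-substL w x a φ)

    occL-substL : ∀ w x a φ → occL X w (substL X x a φ) ≡ occL X w φ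
    occL-substL w x a []      = refl
    occL-substL w x a (c ∷ φ) = cong₂ _∨_ (occC-substC w x a c) (occL-substL w x a φ)

  mutual
    weight-substC : ∀ x a c → weight (substC X x a c) ≡ weight c
    weight-substC x a (xf _)          = refl
    weight-substC x a (mem _ _)       = refl
    weight-substC x a (eqS _ _)       = refl
    weight-substC x a (foreach c S φ) with any (x ≡ᵇ_) (ctVars X c)
    ... | true  = cong (λ n → suc n * (2 + weights φ)) (size-substS x a S)
    ... | false = cong₂ (λ n m → suc n * (2 + m)) (size-substS x a S) (weights-substL x a φ)

    weights-substL : ∀ x a φ → weights (substL X x a φ) ≡ weights φ
    weights-substL x a []      = refl
    weights-substL x a (c ∷ φ) = cong₂ _+_ (weight-substC x a c) (weights-substL x a φ)

  Pure-renameL : ∀ m {φ} → All Pure φ → All Pure (renameL X m φ)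
  Pure-renameL []            p = p
  Pure-renameL ((y , z) ∷ m) p = Pure-renameL m (Pure-substL y (var z) p)

  occL-renameL : ∀ w m φ → occL X w (renameL X m φ) ≡ occL X w φ
  occL-renameL w []            φ = refl
  occL-renameL w ((y , z) ∷ m) φ = trans (occL-renameL w m _) (occL-substL w y (var z) φ)

  weights-renameL : ∀ m φ → weights (renameL X m φ) ≡ weights φ
  weights-renameL []            φ = refl
  weights-renameL ((y , z) ∷ m) φ = trans (weights-renameL m _) (weights-substL y (var z) φ)

  Pure-inst : ∀ c a φ k → All Pure φ → All Pure (proj₁ (inst X c a φ k))
  Pure-inst (cv x)   a φ k p = Pure-substL x a p
  Pure-inst (cp c d) a φ k p = xf-pure ∷ Pure-renameL (proj₁ (proj₂ (freshen X (cp c d) k))) p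

  occL-inst : ∀ w c a φ k → occL X w (proj₁ (inst X c a φ k)) ≡ occL X w φ
  occL-inst w (cv x)   a φ k = occL-substL w x a φ
  occL-inst w (cp c d) a φ k = occL-renameL w (proj₁ (proj₂ (freshen X (cp c d) k))) φ

  weights-inst : ∀ c a φ k → weights (proj₁ (inst X c a φ k)) ≡ weights φ
  weights-inst (cv x)   a φ k = weights-substL x a φ
  weights-inst (cp c d) a φ k = weights-renameL (proj₁ (proj₂ (freshen X (cp c d) k))) φ

  freshen-counter : ∀ c k → k ≤ proj₂ (proj₂ (freshen X c k))
  freshen-counter (cv x)   k = n≤1+n k
  freshen-counter (cp c d) k = ≤-trans (freshen-counter c k) (freshen-counter d _)

  inst-counter : ∀ c a φ k → k ≤ proj₂ (inst X c a φ k)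
  inst-counter (cv x)   a φ k = ≤-refl
  inst-counter (cp c d) a φ k = freshen-counter (cp c d) k

  All-ssubL : ∀ {P : C → Set} v B φ → All (P ∘ ssubC X v B) φ → All P (ssubL X v B φ)
  All-ssubL v B []      []       = []
  All-ssubL v B (_ ∷ φ) (p ∷ ps) = p ∷ All-ssubL v B φ ps

  sum-map-ssubL : ∀ (f g : C → ℕ) v B → (∀ d → f (ssubC X v B d) ≡ g d) →
                  ∀ φ → sum (map f (ssubL X v B φ)) ≡ sum (map g φ)
  sum-map-ssubL f g v B h []      = refl
  sum-map-ssubL f g v B h (d ∷ φ) = cong₂ _+_ (h d) (sum-map-ssubL f g v B h φ)

  membership-ssubC : ∀ v B c → membership (ssubC X v B c) ≡ membership c
  membership-ssubC v B (xf _)          = refl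
  membership-ssubC v B (mem _ _)       = refl
  membership-ssubC v B (eqS _ _)       = refl
  membership-ssubC v B (foreach _ _ _) = refl

  ssubC-equation : ∀ {v w} B A → v ≢ w → ssubC X v B (eqS (svar w) A) ≡ eqS (svar w) (ssubS X v B A)
  ssubC-equation B A v≢w rewrite ≢⇒≡ᵇ≡false v≢w = refl

  mutual
    Pure-ssubC : ∀ v B {c} → Pure c → Pure (ssubC X v B c)
    Pure-ssubC v B xf-pure          = xf-pure
    Pure-ssubC v B (foreach-pure p) = foreach-pure (Pure-ssubL v B p)

    Pure-ssubL : ∀ v B {φ} → All Pure φ → All Pure (ssubL X v B φ)
    Pure-ssubL v B []       = []
    Pure-ssubL v B (p ∷ ps) = Pure-ssubC v B p ∷ Pure-ssubL v B ps

  module _ {w v : ℕ} {B : STm X} (w≢v : w ≢ v) (w∉B : occS X w B ≡ false) where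

    occS-ssubS-other : ∀ S → occS X w (ssubS X v B S) ≡ occS X w S
    occS-ssubS-other ∅         = refl
    occS-ssubS-other (svar u) with v ≡ᵇ u in e
    ... | true  = trans w∉B (sym (≢⇒≡ᵇ≡false λ w≡u → w≢v (trans w≡u u≡v)))
      where u≡v = sym (≡ᵇ≡true⇒≡ v u e)
    ... | false = refl
    occS-ssubS-other (ins _ S) = occS-ssubS-other S

    mutual
      occC-ssubC-other : ∀ c → occC X w (ssubC X v B c) ≡ occC X w c
      occC-ssubC-other (xf _)          = refl
      occC-ssubC-other (mem _ S)       = occS-ssubS-other S
      occC-ssubC-other (eqS S S')      = cong₂ _∨_ (occS-ssubS-other S) (occS-ssubS-other S')
      occC-ssubC-other (foreach _ S φ) = cong₂ _∨_ (occS-ssubS-other S) (occL-ssubL-other φ)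

      occL-ssubL-other : ∀ φ → occL X w (ssubL X v B φ) ≡ occL X w φ
      occL-ssubL-other []      = refl
      occL-ssubL-other (c ∷ φ) = cong₂ _∨_ (occC-ssubC-other c) (occL-ssubL-other φ)

  module _ {v : ℕ} {B : STm X} (v∉B : occS X v B ≡ false) where

    occS-ssubS-self : ∀ S → occS X v (ssubS X v B S) ≡ false
    occS-ssubS-self ∅         = refl
    occS-ssubS-self (svar u) with v ≡ᵇ u in e
    ... | true  = v∉B
    ... | false = e
    occS-ssubS-self (ins _ S) = occS-ssubS-self S

    mutual
      occC-ssubC-self : ∀ c → occC X v (ssubC X v B c) ≡ false
      occC-ssubC-self (xf _)          = refl
      occC-ssubC-self (mem _ S)       = occS-ssubS-self S
      occC-ssubC-self (eqS S S')      = cong₂ _∨_ (occS-ssubS-self S) (occS-ssubS-self S')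
      occC-ssubC-self (foreach _ S φ) = cong₂ _∨_ (occS-ssubS-self S) (occL-ssubL-self φ)

      occL-ssubL-self : ∀ φ → occL X v (ssubL X v B φ) ≡ false
      occL-ssubL-self []      = refl
      occL-ssubL-self (c ∷ φ) = cong₂ _∨_ (occC-ssubC-self c) (occL-ssubL-self φ)

  -- The rewrite rules

  membership-hit : ∀ {k a b B rest} → Focused k (mem a (ins b B)) rest →
                   Advance ⟨ xf (eqX a b) ∷ rest , k ⟩ (mem a (ins b B) ∷ rest)
  membership-hit f =
    advance (proj₁ (quiet-replacement f refl ≤-refl (λ _ _ _ → refl ∷ []) (xf-good ∷ []) (refl ∷ [])))
            (inj₁ (n<1+n _))

  membership-skip : ∀ {k a b B rest} → Focused k (mem a (ins b B)) rest →
                    Advance ⟨ mem a B ∷ rest , k ⟩ (mem a (ins b B) ∷ rest)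
  membership-skip f = advance (proj₁ quiet) (inj₂ (refl , inj₂ (proj₂ quiet , inj₁ (n<1+n _))))
    where
      quiet = quiet-replacement f refl ≤-refl (λ _ _ absent → absent ∷ []) (mem-good ∷ []) (refl ∷ [])

  membership-variable : ∀ {k a u rest} → Focused k (mem a (svar u)) rest →
    Advance ⟨ eqS (svar u) (ins a (svar k)) ∷ rest , suc k ⟩ (mem a (svar u) ∷ rest)
  membership-variable {k} {a} {u} {rest} f =
    advance (invariant-after-replacing f (n≤1+n k) confined (eq-good (≢k u<k) ∷ []) live-new)
            (inj₁ (n<1+n _))
    where
      new = eqS (svar u) (ins a (svar k))
      u<k : u < k
      u<k = occurs⇒<fresh (fresh f) (here refl) (≡ᵇ-refl u)
      ≢k : ∀ {w} → w < k → (w ≡ᵇ k) ≡ false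
      ≢k w<k = ≢⇒≡ᵇ≡false (<⇒≢ w<k)
      confined : Confined k (suc k) (mem a (svar u)) [ new ]
      confined w (inj₁ w<k) w≢u = cong₂ _∨_ w≢u (≢k w<k) ∷ []
      confined w (inj₂ k<w) w≢u = cong₂ _∨_ w≢u (≢⇒≡ᵇ≡false (≢-sym (<⇒≢ k<w))) ∷ []
      live-new : liveness (new ∷ rest) new + 0 ≤ 1
      live-new = subst (_≤ 1) (sym (+-identityʳ _)) (liveness≤1 (new ∷ rest) new)

  substitution-good-dead : ∀ {v B rest d} → d ∈ rest → Good d →
    liveness (eqS (svar v) B ∷ rest) d ≡ 0 →
    Good (ssubC X v B d) × liveness (eqS (svar v) B ∷ ssubL X v B rest) (ssubC X v B d) ≡ 0
  substitution-good-dead d∈rest xf-good          _ = xf-good , refl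
  substitution-good-dead d∈rest mem-good         _ = mem-good , refl
  substitution-good-dead {v} {B} d∈rest (foreach-good p) _ = foreach-good (Pure-ssubL v B p) , refl
  substitution-good-dead {v} {B} {rest} d∈rest (eq-good {w} {a} {A} w∉) dead =
    subst (λ d' → Good d' × liveness Γ' d' ≡ 0) (sym (ssubC-equation B (ins a A) (≢-sym w≢v)))
      (eq-good (trans (occS-ssubS-other w≢v w∉B A) w∉) , cong atLeastTwo once)
    where
      Γ' = eqS (svar v) B ∷ ssubL X v B rest
      facts = occurs-once (eqS (svar v) B) d∈rest (equationVar-occurs (eqS (svar w) (ins a A)) refl)
                          (atLeastTwo≡0⇒≤1 dead)
      w≢v = ≡ᵇ≡false⇒≢ (∨-conicalˡ _ _ (proj₁ facts))
      w∉B = ∨-conicalʳ _ _ (proj₁ facts)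
      once : occurrences w Γ' ≡ 1
      once = cong₂ _+_ (cong oneIf (proj₁ facts))
               (trans (sum-map-ssubL _ _ v B (cong oneIf ∘ occC-ssubC-other w≢v w∉B) rest) (proj₂ facts))

  substitution-fresh : ∀ {k v B rest} → Fresh k (eqS (svar v) B ∷ rest) →
                       Fresh k (eqS (svar v) B ∷ ssubL X v B rest)
  substitution-fresh {v = v} {B} {rest} fresh v' k≤v' =
    All.head absent ∷ All-ssubL v B rest (All.map (λ {d} e → trans (occC-ssubC-other v'≢v v'∉B d) e)
                                                  (All.tail absent))
    where
      absent = fresh v' k≤v'
      v<k = occurs⇒<fresh fresh (here refl) (equationVar-occurs (eqS (svar v) B) refl)
      v'≢v = ≢-sym (<⇒≢ (<-≤-trans v<k k≤v'))
      v'∉B = ∨-conicalʳ _ _ (All.head absent)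

  equation-substitution : ∀ {k v a A rest} → occS X v (ins a A) ≡ false → occL X v rest ≡ true →
    Focused k (eqS (svar v) (ins a A)) rest →
    Advance ⟨ eqS (svar v) (ins a A) ∷ ssubL X v (ins a A) rest , k ⟩ (eqS (svar v) (ins a A) ∷ rest)
  equation-substitution {v = v} {a} {A} {rest} v∉B occurs f =
    advance (record { good   = eq-good v∉B ∷ All-ssubL v B rest (All.map proj₁ substituted)
                    ; fresh  = substitution-fresh (fresh f)
                    ; live≤1 = subst (_≤ 1) (sym live-new) z≤n })
            (inj₂ (memberships≡ , inj₁ (subst₂ _<_ (sym live-new) (sym live-old) (n<1+n 0))))
    where
      B = ins a A
      c = eqS (svar v) B
      substituted = All.tabulate λ d∈ →
        substitution-good-dead d∈ (All.lookup (good-rest f) d∈) (All.lookup (rest-dead f) d∈)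

      live-new : live (c ∷ ssubL X v B rest) ≡ 0
      live-new = cong₂ _+_ (trans (liveness-equation v B (ssubL X v B rest))
                                  (cong oneIf (occL-ssubL-self {v} {B} v∉B rest)))
                           (sum-map-≡0⁺ _ (All-ssubL v B rest (All.map proj₂ substituted)))

      live-old : live (c ∷ rest) ≡ 1
      live-old = cong₂ _+_ (trans (liveness-equation v B rest) (cong oneIf occurs))
                           (sum-map-≡0⁺ _ (rest-dead f))

      memberships≡ : sum (map membership (c ∷ ssubL X v B rest)) ≡ sum (map membership (c ∷ rest))
      memberships≡ = sum-map-ssubL _ _ v B (membership-ssubC v B) rest

  foreach-empty : ∀ {k c φ rest} → Focused k (foreach c ∅ φ) rest →
                  Advance ⟨ rest , k ⟩ (foreach c ∅ φ ∷ rest)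
  foreach-empty f = advance (proj₁ quiet) (inj₂ (refl , inj₂ (proj₂ quiet , inj₂ (refl , weight<))))
    where
      quiet = quiet-replacement {Δ = []} f refl ≤-refl (λ _ _ _ → []) [] []
      weight< = s≤s (m≤n⇒m≤1+n (m≤n+m _ _))

  weight-instance : ∀ c a A φ k →
    sum (map weight (proj₁ (inst X c a φ k) ++ [ foreach c A φ ])) < weight (foreach c (ins a A) φ)
  weight-instance c a A φ k = subst (_< _) (sym instances) (m<n⇒m<1+n (n<1+n _))
    where
      φa = proj₁ (inst X c a φ k)
      instances : sum (map weight (φa ++ [ foreach c A φ ])) ≡ weights φ + suc (size A) * (2 + weights φ)
      instances = trans (sum-map-++ weight φa [ foreach c A φ ])
                    (cong₂ _+_ (trans (sym (weights≡sum φa)) (weights-inst c a φ k)) (+-identityʳ _))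

  foreach-instance : ∀ {k c a A φ rest} → All Pure φ → Focused k (foreach c (ins a A) φ) rest →
    Advance ⟨ proj₁ (inst X c a φ k) ++ (foreach c A φ ∷ rest) , proj₂ (inst X c a φ k) ⟩
            (foreach c (ins a A) φ ∷ rest)
  foreach-instance {k} {c} {a} {A} {φ} {rest} p f =
    subst (λ Γ' → Advance ⟨ Γ' , _ ⟩ _) (++-assoc φa [ foreach c A φ ] rest)
      (advance (proj₁ quiet) (inj₂ (memberships≡ , inj₂ (proj₂ quiet , inj₂ (sizes≡ , weight<)))))
    where
      φa = proj₁ (inst X c a φ k)
      Δ = φa ++ [ foreach c A φ ]
      pureΔ : All Pure Δ
      pureΔ = ++⁺ (Pure-inst c a φ k p) (foreach-pure p ∷ [])
      confined : Confined k (proj₂ (inst X c a φ k)) (foreach c (ins a A) φ) Δ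
      confined w _ absent =
        ++⁺ (occL≡false⇒All w φa (trans (occL-inst w c a φ k) (∨-conicalʳ _ _ absent))) (absent ∷ [])
      quiet = quiet-replacement f refl (inst-counter c a φ k) confined (All.map Pure⇒Good pureΔ)
                (All.map (λ { xf-pure → refl ; (foreach-pure _) → refl }) pureΔ)

      vanishes : ∀ (g : C → ℕ) → (∀ {d} → Pure d → g d ≡ 0) →
                 sum (map g (Δ ++ rest)) ≡ sum (map g rest)
      vanishes g h = trans (sum-map-++ g Δ rest) (cong (_+ _) (sum-map-≡0⁺ g (All.map h pureΔ)))
      memberships≡ = vanishes membership λ { xf-pure → refl ; (foreach-pure _) → refl }
      sizes≡       = vanishes memberSize λ { xf-pure → refl ; (foreach-pure _) → refl }
      weight< = subst (_< _) (sym (sum-map-++ weight Δ rest)) (+-monoˡ-< _ (weight-instance c a A φ k))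

  rule-advances : ∀ {k c rest bs s'} → Good c → Focused k c rest →
                  rule X c rest k ≡ just bs → s' ∈ bs → Advance s' (c ∷ rest)
  rule-advances xf-good f () _
  rule-advances (mem-good {A = ∅})       f refl ()
  rule-advances (mem-good {A = ins _ _}) f refl (here refl)         = membership-hit f
  rule-advances (mem-good {A = ins _ _}) f refl (there (here refl)) = membership-skip f
  rule-advances (mem-good {A = svar _})  f refl (here refl)         = membership-variable f
  rule-advances {rest = rest} (eq-good {v} v∉B) f fires s'∈bs with occL X v rest in occurs
  rule-advances (eq-good v∉B) f refl (here refl) | true = equation-substitution v∉B occurs f
  rule-advances (foreach-good {A = ∅} _)       f refl (here refl) = foreach-empty f
  rule-advances (foreach-good {A = ins _ _} p) f refl (here refl) = foreach-instance p f
  rule-advances (foreach-good {A = svar _} _)  f () _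

  -- The implementation and its termination

  isEquation : C → Bool
  isEquation (eqS _ _) = true
  isEquation _         = false

  reducibleEquation : C → List C → ℕ → Bool
  reducibleEquation c rest k = isEquation c ∧ is-just (rule X c rest k)

  liveness-good : ∀ {c rest} k → Good c → liveness (c ∷ rest) c ≡ oneIf (reducibleEquation c rest k)
  liveness-good k xf-good          = refl
  liveness-good k mem-good         = refl
  liveness-good k (foreach-good _) = refl
  liveness-good {rest = rest} k (eq-good {v} {a} {A} _) =
    trans (liveness-equation v (ins a A) rest) (cong oneIf (sym (is-just-if (occL X v rest))))

  Reducible ReducibleEquation : (s : State X) → Fin (length (cons s)) → Set
  Reducible s i         = T (is-just (ruleAt X s i))
  ReducibleEquation s i = T (reducibleEquation (lookup (cons s) i) (removeAt (cons s) i) (ctr s))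

  reducible? : ∀ s → Decidable (Reducible s)
  reducible? s i = T? _

  reducibleEquation? : ∀ s → Decidable (ReducibleEquation s)
  reducibleEquation? s i = T? _

  choose : (s : State X) → Maybe (Fin (length (cons s)))
  choose s with any? (reducibleEquation? s)
  ... | yes (i , _) = just i
  ... | no _ with any? (reducible? s)
  ...   | yes (i , _) = just i
  ...   | no _        = nothing

  data Choice (s : State X) : Maybe (Fin (length (cons s))) → Set where
    equation : ∀ {i} → ReducibleEquation s i → Choice s (just i)
    other    : ∀ {i} → Reducible s i → (∀ j → ¬ ReducibleEquation s j) → Choice s (just i)
    fixpoint : (∀ j → ¬ Reducible s j) → Choice s nothing

  choice : ∀ s → Choice s (choose s)
  choice s with any? (reducibleEquation? s)
  ... | yes (i , r) = equation r
  ... | no ¬eq with any? (reducible? s)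
  ...   | yes (i , r) = other r λ j r' → ¬eq (j , r')
  ...   | no ¬red     = fixpoint λ j r → ¬red (j , r)

  chosen : ∀ s {m} → choose s ≡ m → Choice s m
  chosen s e = subst (Choice s) e (choice s)

  chosen-reducible : ∀ {s i} → Choice s (just i) → Reducible s i
  chosen-reducible (equation r) = proj₂ (Equivalence.to T-∧ r)
  chosen-reducible (other r _)  = r

  equationsFirst : Implementation X
  equationsFirst = record
    { choose     = choose
    ; choose-red = λ s i e → is-just⇒≡just (chosen-reducible (chosen s e))
    ; choose-fix = λ s e → fixpoint-irreducible (chosen s e)
    }
    where
      fixpoint-irreducible : ∀ {s} → Choice s nothing → ∀ i → ruleAt X s i ≡ nothing
      fixpoint-irreducible (fixpoint ¬red) i = ¬is-just⇒≡nothing (¬red i)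

  chosen-rest-dead : ∀ {k Γ i} → Invariant k Γ → Choice ⟨ Γ , k ⟩ (just i) →
                     Dead (lookup Γ i ∷ removeAt Γ i) (removeAt Γ i)
  chosen-rest-dead {k} {Γ} {i} inv (equation r) = sum-map-≡0⁻ _ rest (n≤0⇒n≡0 (≤-pred live-rest))
    where
      rest = removeAt Γ i
      inv' = Invariant-↭ (↭-sym (lookup∷removeAt↭ Γ i)) inv
      live-c = trans (liveness-good k (All.head (good inv'))) (oneIf-T r)
      live-rest : 1 + sum (map (liveness (lookup Γ i ∷ rest)) rest) ≤ 1
      live-rest = subst (λ n → n + sum (map (liveness (lookup Γ i ∷ rest)) rest) ≤ 1)
                        live-c (live≤1 inv')
  chosen-rest-dead {k} {Γ} {i} inv (other _ no-equation) =
    All.tail (Dead-↭ p p (All-lookup⁺ Γ λ j →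
      trans (liveness-↭ (↭-sym (lookup∷removeAt↭ Γ j)) (lookup Γ j))
            (trans (liveness-good k (All.lookup (good inv) (∈-lookup j))) (oneIf-¬T (no-equation j)))))
    where p = ↭-sym (lookup∷removeAt↭ Γ i)

  step-advances : ∀ {s s'} → Invariant (ctr s) (cons s) → Step X equationsFirst s s' →
                  Advance s' (cons s)
  step-advances {⟨ Γ , k ⟩} inv (i , chose , bs , fires , s'∈bs) =
    advance (Advance.invariant adv) (subst (_ ⊏_) (μ-↭ p) (Advance.decrease adv))
    where
      p = lookup∷removeAt↭ Γ i
      inv' = Invariant-↭ (↭-sym p) inv
      focused = record { good-rest = All.tail (good inv') ; fresh = fresh inv'
                       ; rest-dead = chosen-rest-dead inv (chosen _ chose) }
      adv = rule-advances (All.head (good inv')) focused fires s'∈bs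

  terminates : ∀ {s} → Invariant (ctr s) (cons s) → Acc _⊏_ (μ (cons s)) →
               Terminates X equationsFirst s
  terminates inv (acc rs) = acc λ step →
    let adv = step-advances inv step in terminates (Advance.invariant adv) (rs (Advance.decrease adv))

  -- Initial states

  data Initial : C → Set where
    mem-initial  : ∀ {a A} → Initial (mem a A)
    pure-initial : ∀ {c} → Pure c → Initial c

  Initial⇒Good : ∀ {c} → Initial c → Good c
  Initial⇒Good mem-initial      = mem-good
  Initial⇒Good (pure-initial p) = Pure⇒Good p

  Initial-dead : ∀ Γ {c} → Initial c → liveness Γ c ≡ 0
  Initial-dead Γ mem-initial                     = refl
  Initial-dead Γ (pure-initial xf-pure)          = refl
  Initial-dead Γ (pure-initial (foreach-pure _)) = refl

  foreachChain-pure : ∀ r φ → All Pure (foreachChain X r φ)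
  foreachChain-pure []            φ = xf-pure ∷ []
  foreachChain-pure ((y , B) ∷ r) φ = foreach-pure (foreachChain-pure r φ) ∷ []

  existsChain-initial : ∀ r ψ → All Initial ψ → All Initial (existsChain X r ψ)
  existsChain-initial []            ψ h = h
  existsChain-initial ((x , A) ∷ r) ψ h = mem-initial ∷ existsChain-initial r ψ h

  conjCons-initial : ∀ ps → All Initial (conjCons X ps)
  conjCons-initial []       = []
  conjCons-initial (p ∷ ps) = ++⁺
    (existsChain-initial (PureEA.ex₁ p ∷ PureEA.exs p) _
      (All.map pure-initial (foreachChain-pure (PureEA.fas p) (PureEA.body p))))
    (conjCons-initial ps)

  occS-varsS : ∀ v S → occS X v S ≡ true → v ∈ varsS X S
  occS-varsS v (svar w)  e rewrite ≡ᵇ≡true⇒≡ v w e = here refl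
  occS-varsS v (ins t S) e = ∈-++⁺ʳ (varsT t) (occS-varsS v S e)

  mutual
    occC-varsC : ∀ v c → occC X v c ≡ true → v ∈ varsC X c
    occC-varsC v (mem t S) e = ∈-++⁺ʳ (varsT t) (occS-varsS v S e)
    occC-varsC v (eqS S S') e with ∨≡true⇒ (occS X v S) e
    ... | inj₁ o = ∈-++⁺ˡ (occS-varsS v S o)
    ... | inj₂ o = ∈-++⁺ʳ (varsS X S) (occS-varsS v S' o)
    occC-varsC v (foreach c S φ) e with ∨≡true⇒ (occS X v S) e
    ... | inj₁ o = ∈-++⁺ʳ (ctVars X c) (∈-++⁺ˡ (occS-varsS v S o))
    ... | inj₂ o = ∈-++⁺ʳ (ctVars X c) (∈-++⁺ʳ (varsS X S) (occL-varsL v φ o))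

    occL-varsL : ∀ v φ → occL X v φ ≡ true → v ∈ varsL X φ
    occL-varsL v (c ∷ φ) e with ∨≡true⇒ (occC X v c) e
    ... | inj₁ o = ∈-++⁺ˡ (occC-varsC v c o)
    ... | inj₂ o = ∈-++⁺ʳ (varsC X c) (occL-varsL v φ o)

  FreshFor⇒Fresh : ∀ {k Γ} → FreshFor X k Γ → Fresh k Γ
  FreshFor⇒Fresh {Γ = Γ} fresh v k≤v with occL X v Γ in e
  ... | true  = contradiction (fresh v (occL-varsL v Γ e)) (≤⇒≯ k≤v)
  ... | false = occL≡false⇒All v Γ e

  initial-invariant : ∀ ps k → FreshFor X k (conjCons X ps) → Invariant k (conjCons X ps)
  initial-invariant ps k fresh = record
    { good   = All.map Initial⇒Good (conjCons-initial ps)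
    ; fresh  = FreshFor⇒Fresh fresh
    ; live≤1 = ≤-trans (≤-reflexive live≡0) z≤n
    }
    where
      live≡0 : live (conjCons X ps) ≡ 0
      live≡0 = sum-map-≡0⁺ _ (All.map (Initial-dead (conjCons X ps)) (conjCons-initial ps))

theorem5 : (X : XTheory) → Σ (Implementation X) λ impl →
    (Γ : List (PureEA X)) (k : ℕ) → FreshFor X k (conjCons X Γ) →
    Terminates X impl ⟨ conjCons X Γ , k ⟩
theorem5 X = equationsFirst , λ Γ k fresh →
  terminates (initial-invariant Γ k fresh) (⊏-wellFounded _)
  where open Termination X
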